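{- Let $F$ be a chordal graph, let $x,y$ be nonadjacent vertices of $F$, and let $(V_S,E_S)$ be an inclusion-wise minimal mixed $x$–$y$ separator in $F$. Then every connected component of the graph obtained from $F$ by deleting the vertices of $V_S$ and the edges of $E_S$ is chordal.
   Context: A graph is chordal if it has no induced cycle on at least four vertices. For nonadjacent vertices $x,y$ of a graph $F$, a mixed $x$–$y$ separator is a pair $(V_S,E_S)$ with $V_S\subseteq V(F)\setminus\{x,y\}$ and $E_S\subseteq E(F)$ such that deleting $V_S$ and $E_S$ from $F$ leaves $x$ and $y$ in different components; its size is $(|V_S|,|E_S|)$. It is inclusion-wise minimal if there is no other mixed $x$–$y$ separator $(V'_S,E'_S)$ with $V'_S\subseteq V_S$ and $E'_S\subseteq E_S$. -}

module Defs where

open import Data.Nat using (ℕ; suc; _≤_)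
open import Data.Fin using (Fin; toℕ)
open import Data.Product using (_×_; ∃)
open import Data.Sum using (_⊎_)
open import Data.Unit using (⊤)
open import Relation.Nullary using (¬_; Dec)
open import Relation.Binary.PropositionalEquality using (_≡_)
open import Relation.Binary.Construct.Closure.ReflexiveTransitive using (Star)
open import Function.Bundles using (_⇔_)

record Graph (n : ℕ) : Set₁ where
  field
    Adj    : Fin n → Fin n → Set
    sym    : ∀ {u v} → Adj u v → Adj v u
    irrefl : ∀ {u} → ¬ Adj u u
    dec    : ∀ u v → Dec (Adj u v)
open Graph public

CycSucc : (k : ℕ) → Fin k → Fin k → Set
CycSucc k i j = (suc (toℕ i) ≡ toℕ j) ⊎ ((suc (toℕ i) ≡ k) × (toℕ j ≡ 0))

CycAdj : (k : ℕ) → Fin k → Fin k → Set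
CycAdj k i j = CycSucc k i j ⊎ CycSucc k j i

InducedCycle : {n : ℕ} → (Fin n → Fin n → Set) → (Fin n → Set) →
               (k : ℕ) → (Fin k → Fin n) → Set
InducedCycle A P k c =
  (∀ i → P (c i)) ×
  (∀ i j → c i ≡ c j → i ≡ j) ×
  (∀ i j → A (c i) (c j) ⇔ CycAdj k i j)

ChordalOn : {n : ℕ} → (Fin n → Fin n → Set) → (Fin n → Set) → Set
ChordalOn {n} A P = ∀ k → 4 ≤ k → (c : Fin k → Fin n) → ¬ InducedCycle A P k c

Chordal : {n : ℕ} → Graph n → Set
Chordal F = ChordalOn (Adj F) (λ _ → ⊤)

DelAdj : {n : ℕ} → Graph n → (Fin n → Set) → (Fin n → Fin n → Set) →
         Fin n → Fin n → Set
DelAdj F VS ES u v = Adj F u v × ¬ ES u v × ¬ VS u × ¬ VS v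

-- A mixed x–y separator (VS, ES): VS ⊆ V(F) ∖ {x,y}, ES ⊆ E(F)
-- (ES is a symmetric relation representing a set of unordered edges),
-- and x, y are disconnected in F - VS - ES.
record MixedSep {n : ℕ} (F : Graph n) (x y : Fin n) : Set₁ where
  field
    VS     : Fin n → Set
    ES     : Fin n → Fin n → Set
    ES-sym : ∀ {u v} → ES u v → ES v u
    ES⊆E   : ∀ {u v} → ES u v → Adj F u v
    x∉VS   : ¬ VS x
    y∉VS   : ¬ VS y
    sep    : ¬ Star (DelAdj F VS ES) x y
open MixedSep public

MinimalSep : {n : ℕ} {F : Graph n} {x y : Fin n} → MixedSep F x y → Set₁
MinimalSep {F = F} {x} {y} S =
  (S' : MixedSep F x y) →
  (∀ v → VS S' v → VS S v) →
  (∀ u v → ES S' u v → ES S u v) →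
  (∀ v → VS S v → VS S' v) × (∀ u v → ES S u v → ES S' u v)

-- C is (the vertex set of) a connected component of the graph with
-- vertex set {v | ¬ VS v} and adjacency A (A only relates such vertices).
IsComponent : {n : ℕ} → (Fin n → Set) → (Fin n → Fin n → Set) →
              (Fin n → Set) → Set
IsComponent VS A C =
  (∀ v → C v → ¬ VS v) ×
  (∃ λ v → C v) ×
  (∀ u v → C u → C v → Star A u v) ×
  (∀ u v → C u → A u v → C v)

-- A minimal separator never deletes an edge uv with u and v in the same
-- component C of F - VS - ES: u and v are already joined by a path in that
-- graph, so putting uv back keeps x and y apart, contradicting minimality.
-- Hence on C the deletion graph agrees with F, and an induced cycle in C
-- is an induced cycle of F.
module Submission where

open import Defs
open import Data.Nat using (ℕ)
open import Data.Fin using (Fin)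
open import Data.Product using (_×_; _,_; proj₁; proj₂)
open import Data.Unit using (tt)
open import Function using (_∘_)
open import Function.Bundles using (_⇔_; mk⇔; Equivalence)
open import Level using (0ℓ)
open import Relation.Binary.Core using (Rel)
open import Relation.Binary.Construct.Closure.ReflexiveTransitive using (Star; ε; _◅_; _◅◅_)
open import Relation.Nullary using (¬_)

star-¬¬-concat : ∀ {n} {R T : Rel (Fin n) 0ℓ} →
  (∀ {u v} → R u v → ¬ ¬ Star T u v) →
  ∀ {u v} → Star R u v → ¬ ¬ Star T u v
star-¬¬-concat step ε k = k ε
star-¬¬-concat step (r ◅ rs) k =
  step r λ p → star-¬¬-concat step rs λ q → k (p ◅◅ q)

chordalOn-restrict : ∀ {n} {A A′ : Rel (Fin n) 0ℓ} {P Q : Fin n → Set} →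
  (∀ v → P v → Q v) →
  (∀ u v → P u → P v → A′ u v ⇔ A u v) →
  ChordalOn A Q → ChordalOn A′ P
chordalOn-restrict {A = A} {A′} P⊆Q A′⇔A chordal k 4≤k c (inP , inj , induced) =
  chordal k 4≤k c ((λ i → P⊆Q (c i) (inP i)) , inj , λ i j →
    mk⇔ (Equivalence.to (induced i j) ∘ Equivalence.from (edge i j))
        (Equivalence.to (edge i j) ∘ Equivalence.from (induced i j)))
  where
  edge : ∀ i j → A′ (c i) (c j) ⇔ A (c i) (c j)
  edge i j = A′⇔A (c i) (c j) (inP i) (inP j)

module _ {n : ℕ} {F : Graph n} {x y : Fin n} (S : MixedSep F x y)
         (C : Fin n → Set)
         (connected : ∀ u v → C u → C v → Star (DelAdj F (VS S) (ES S)) u v) where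

  InternalFreeES : Fin n → Fin n → Set
  InternalFreeES u v = ES S u v × ¬ (C u × C v)

  -- Neither ES nor C is decidable, so the detour through C is only obtained
  -- under ¬ ¬; that suffices since separation is itself a negation.
  restoredEdge-¬¬path : ∀ {u v} → DelAdj F (VS S) InternalFreeES u v →
                        ¬ ¬ Star (DelAdj F (VS S) (ES S)) u v
  restoredEdge-¬¬path {u} {v} (a , ¬es′ , u∉VS , v∉VS) k =
    k ((a , ¬es , u∉VS , v∉VS) ◅ ε)
    where
    ¬es : ¬ ES S u v
    ¬es es = ¬es′ (es , λ { (Cu , Cv) → k (connected u v Cu Cv) })

  restoreInternalEdges : MixedSep F x y
  restoreInternalEdges = record
    { VS     = VS S
    ; ES     = InternalFreeES
    ; ES-sym = λ { (es , ¬CC) → ES-sym S es , λ { (Cu , Cv) → ¬CC (Cv , Cu) } }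
    ; ES⊆E   = λ es → ES⊆E S (proj₁ es)
    ; x∉VS   = x∉VS S
    ; y∉VS   = y∉VS S
    ; sep    = λ p → star-¬¬-concat restoredEdge-¬¬path p (sep S)
    }

  minimalSep⇒noInternalEdge : MinimalSep S → ∀ {u v} → C u → C v → ¬ ES S u v
  minimalSep⇒noInternalEdge minimal {u} {v} Cu Cv es =
    proj₂ (ES⊆ES′ u v es) (Cu , Cv)
    where
    ES⊆ES′ : ∀ u v → ES S u v → InternalFreeES u v
    ES⊆ES′ = proj₂ (minimal restoreInternalEdges (λ _ V → V) (λ _ _ → proj₁))

proposition11 : {n : ℕ} (F : Graph n) → Chordal F →
    (x y : Fin n) → ¬ Adj F x y →
    (S : MixedSep F x y) → MinimalSep S →
    (C : Fin n → Set) → IsComponent (VS S) (DelAdj F (VS S) (ES S)) C →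
    ChordalOn (DelAdj F (VS S) (ES S)) C
proposition11 F chordal x y _ S minimal C (C∩VS=∅ , _ , connected , _) =
  chordalOn-restrict (λ _ _ → tt) delAdj⇔adj chordal
  where
  delAdj⇔adj : ∀ u v → C u → C v → DelAdj F (VS S) (ES S) u v ⇔ Adj F u v
  delAdj⇔adj u v Cu Cv = mk⇔ proj₁ λ a →
    a , minimalSep⇒noInternalEdge S C connected minimal Cu Cv ,
    C∩VS=∅ u Cu , C∩VS=∅ v Cv
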